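{- Let $R$ be a commutative ring with identity, let $A,B\in R$, and let $(w_n)_{n\ge0}$ be a sequence of elements of $R$ satisfying $w_{n+1}=Aw_n-Bw_{n-1}$ for all $n=1,2,3,\ldots$. Then for any integer $n>1$, $$\det[w_{|j-k+1|}]_{1\le j,k\le n}=(w_1^2-Aw_0w_1+Bw_0^2)\big((B+1)w_1-Aw_0\big)^{n-2}.$$
   Context: The convention $0^0=1$ is used. -}

module Defs where

open import Level using (Level)
open import Algebra.Bundles using (CommutativeRing)
open import Data.Nat using (ℕ; zero; suc)
open import Data.Fin using (Fin; zero; suc; toℕ; punchIn)

module _ {c ℓ : Level} (R : CommutativeRing c ℓ) where
  open CommutativeRing R hiding (zero)

  sumFin : (n : ℕ) → (Fin n → Carrier) → Carrier
  sumFin zero    f = 0#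
  sumFin (suc n) f = f zero + sumFin n (λ i → f (suc i))

  sign : ℕ → Carrier
  sign zero    = 1#
  sign (suc k) = - sign k

  pow : Carrier → ℕ → Carrier
  pow x zero    = 1#
  pow x (suc k) = x * pow x k

  minor : {n : ℕ} → (Fin (suc n) → Fin (suc n) → Carrier) → Fin (suc n)
        → Fin n → Fin n → Carrier
  minor M k i j = M (suc i) (punchIn k j)

  det : (n : ℕ) → (Fin n → Fin n → Carrier) → Carrier
  det zero    M = 1#
  det (suc n) M = sumFin (suc n) (λ k → sign (toℕ k) * (M zero k * det n (minor M k)))

{-# OPTIONS --safe #-}
-- Index rows and columns from 0, so that the entry in row j and column k is w ∣j+1-k∣.
-- Replacing every row j ≥ 2 by row j − A·row (j−1) + B·row (j−2), computed from the
-- original rows, does not change the determinant. By the recurrence the new row j vanishes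
-- in the columns k < j and equals (B+1)w₁ − Aw₀ in column j, so the matrix becomes block
-- upper triangular with leading block [[w₁, w₀], [w₂, w₁]], whose determinant w₁² − w₀w₂
-- is w₁² − Aw₀w₁ + Bw₀².
-- With the determinant given by expansion along the first row, the row calculus comes from
-- linearity in each row and vanishing for two equal adjacent rows (expanding along both);
-- adjacent swaps then change the sign, so any two equal rows give 0, and adding a multiple
-- of another row leaves the determinant unchanged.
module Submission where

open import Defs
open import Level using (Level)
open import Algebra.Bundles using (CommutativeRing)
open import Data.Nat using (ℕ; zero; suc; ∣_-_∣; _≤_; _<_; z≤n; s≤s; _≟_; _<?_)
import Data.Nat as ℕ
open import Data.Nat.Properties as ℕₚ
  using ( suc-injective; ≤-trans; ≤-pred; <-irrefl; n≤1+n; n<1+n; m≤n+m; m≤n⇒m≤1+n; m<n⇒m<1+n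
        ; m≤n⇒m<n∨m≡n; <⇒≢; >⇒≢; ≤∧≢⇒<; +-suc
        ; ∣n-n∣≡0; m≤n⇒∣n-m∣≡n∸m; m≤n⇒∣m-n∣≡n∸m; +-∸-assoc; m+n∸n≡m )
open import Data.Fin using (Fin; zero; suc; toℕ; punchIn)
open import Data.Vec.Functional using (_∷_)
open import Data.Sum using (inj₁; inj₂)
open import Function using (_∘_)
open import Relation.Binary.PropositionalEquality as ≡ using (_≡_; _≢_; _≗_)
open import Relation.Nullary using (Dec; yes; no; ¬_; contradiction)
import Relation.Binary.Reasoning.Setoid as SetoidReasoning

module Determinant {c ℓ : Level} (R : CommutativeRing c ℓ) where
  open CommutativeRing R hiding (zero)
  open import Algebra.Properties.Ring ring
    using (-1*x≈-x; -0#≈0#; -‿involutive; -‿distribˡ-*; -‿distribʳ-*; -‿+-comm; +-inverseʳ-unique)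
  open import Algebra.Properties.Semiring.Sum semiring
    using (sum; sum-cong-≋; ∑-distrib-+; *-distribˡ-sum; sum-replicate-zero)
  open import Data.Vec.Functional.Relation.Binary.Equality.Setoid setoid
    using (_≋_; ≋-reflexive; ≋-sym; ≋-trans)
  open import Relation.Binary.Reasoning.Setoid setoid
  open import Algebra.Solver.Ring.NaturalCoefficients.Default commutativeSemiring
    using (solve; _:=_; _:+_; _:*_)

  sumFin≡sum : ∀ n (f : Fin n → Carrier) → sumFin R n f ≡ sum f
  sumFin≡sum zero    f = ≡.refl
  sumFin≡sum (suc n) f = ≡.cong (f zero +_) (sumFin≡sum n (f ∘ suc))

  sumFin-cong : ∀ {n} {f g : Fin n → Carrier} → f ≋ g → sumFin R n f ≈ sumFin R n g
  sumFin-cong {n} {f} {g} f≋g rewrite sumFin≡sum n f | sumFin≡sum n g = sum-cong-≋ f≋g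

  sumFin-+ : ∀ {n} (f g : Fin n → Carrier) →
             sumFin R n (λ i → f i + g i) ≈ sumFin R n f + sumFin R n g
  sumFin-+ {n} f g rewrite sumFin≡sum n (λ i → f i + g i) | sumFin≡sum n f | sumFin≡sum n g =
    ∑-distrib-+ f g

  sumFin-*ˡ : ∀ {n} x (f : Fin n → Carrier) → sumFin R n (λ i → x * f i) ≈ x * sumFin R n f
  sumFin-*ˡ {n} x f rewrite sumFin≡sum n (λ i → x * f i) | sumFin≡sum n f =
    sym (*-distribˡ-sum x f)

  sumFin-neg : ∀ {n} (f : Fin n → Carrier) → sumFin R n (λ i → - f i) ≈ - sumFin R n f
  sumFin-neg f = begin
    sumFin R _ (λ i → - f i)      ≈⟨ sumFin-cong (λ i → sym (-1*x≈-x (f i))) ⟩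
    sumFin R _ (λ i → - 1# * f i) ≈⟨ sumFin-*ˡ (- 1#) f ⟩
    - 1# * sumFin R _ f           ≈⟨ -1*x≈-x _ ⟩
    - sumFin R _ f                ∎

  sumFin-zero : ∀ {n} {f : Fin n → Carrier} → (∀ i → f i ≈ 0#) → sumFin R n f ≈ 0#
  sumFin-zero {n} {f} f≈0 rewrite sumFin≡sum n f = trans (sum-cong-≋ f≈0) (sum-replicate-zero n)

  sumFin-linear : ∀ {n} x {f g h : Fin n → Carrier} → (∀ i → h i ≈ f i + x * g i) →
                  sumFin R n h ≈ sumFin R n f + x * sumFin R n g
  sumFin-linear x {f} {g} {h} h≈ = begin
    sumFin R _ h                            ≈⟨ sumFin-cong h≈ ⟩
    sumFin R _ (λ i → f i + x * g i)        ≈⟨ sumFin-+ f (λ i → x * g i) ⟩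
    sumFin R _ f + sumFin R _ (λ i → x * g i) ≈⟨ +-congˡ (sumFin-*ˡ x g) ⟩
    sumFin R _ f + x * sumFin R _ g         ∎

  Row : ℕ → Set c
  Row n = Fin n → Carrier

  -- Rows are indexed by ℕ rather than Fin n, so that replacing a row needs no Fin
  -- arithmetic; rows from n on are ignored by detRows.
  Rows : ℕ → Set c
  Rows n = ℕ → Row n

  detRows : (n : ℕ) → Rows n → Carrier
  detRows n ρ = det R n (ρ ∘ toℕ)

  minorRows : ∀ {n} → Rows (suc n) → Fin (suc n) → Rows n
  minorRows ρ k i = ρ (suc i) ∘ punchIn k

  cofactor : ∀ {n} → Rows (suc n) → Fin (suc n) → Carrier
  cofactor ρ k = sign R (toℕ k) * (ρ 0 k * detRows _ (minorRows ρ k))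

  detRows-cong : ∀ {n} {ρ σ : Rows n} → (∀ i → i < n → ρ i ≋ σ i) → detRows n ρ ≈ detRows n σ
  detRows-cong {zero}  _   = refl
  detRows-cong {suc n} ρ≋σ = sumFin-cong λ k → *-congˡ {sign R (toℕ k)} (*-cong (ρ≋σ 0 (s≤s z≤n) k)
    (detRows-cong λ i i<n → ρ≋σ (suc i) (s≤s i<n) ∘ punchIn k))

  detRows-linear : ∀ {n} j → j < n → ∀ x {ρ σ τ : Rows n} →
                   (∀ l → l ≢ j → ρ l ≋ σ l) → (∀ l → l ≢ j → ρ l ≋ τ l) →
                   ρ j ≋ (λ k → σ j k + x * τ j k) →
                   detRows n ρ ≈ detRows n σ + x * detRows n τ
  detRows-linear {suc n} zero _ x {ρ} {σ} {τ} ρ≋σ ρ≋τ ρ₀ = sumFin-linear x λ k → begin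
      s k * (ρ 0 k * detRows n (minorRows ρ k))
    ≈⟨ *-congˡ (*-congʳ (ρ₀ k)) ⟩
      s k * ((σ 0 k + x * τ 0 k) * detRows n (minorRows ρ k))
    ≈⟨ linear-in-entry (s k) (σ 0 k) x (τ 0 k) (detRows n (minorRows ρ k)) ⟩
      s k * (σ 0 k * detRows n (minorRows ρ k)) + x * (s k * (τ 0 k * detRows n (minorRows ρ k)))
    ≈⟨ +-cong (*-congˡ (*-congˡ (minor≈ ρ≋σ k))) (*-congˡ (*-congˡ (*-congˡ (minor≈ ρ≋τ k)))) ⟩
      cofactor σ k + x * cofactor τ k
    ∎
    where
    s : Fin (suc n) → Carrier
    s = sign R ∘ toℕ
    minor≈ : ∀ {υ} → (∀ l → l ≢ 0 → ρ l ≋ υ l) →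
             ∀ k → detRows n (minorRows ρ k) ≈ detRows n (minorRows υ k)
    minor≈ ρ≋υ k = detRows-cong λ i _ → ρ≋υ (suc i) (λ ()) ∘ punchIn k
    linear-in-entry : ∀ s b x c d → s * ((b + x * c) * d) ≈ s * (b * d) + x * (s * (c * d))
    linear-in-entry = solve 5 (λ s b x c d → s :* ((b :+ x :* c) :* d) := s :* (b :* d) :+ x :* (s :* (c :* d))) refl
  detRows-linear {suc n} (suc j) (s≤s j<n) x {ρ} {σ} {τ} ρ≋σ ρ≋τ ρⱼ = sumFin-linear x λ k → begin
      s k * (ρ 0 k * detRows n (minorRows ρ k))
    ≈⟨ *-congˡ (*-congˡ (detRows-linear j j<n x
         (λ l l≢j → ρ≋σ (suc l) (l≢j ∘ suc-injective) ∘ punchIn k)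
         (λ l l≢j → ρ≋τ (suc l) (l≢j ∘ suc-injective) ∘ punchIn k)
         (ρⱼ ∘ punchIn k))) ⟩
      s k * (ρ 0 k * (detRows n (minorRows σ k) + x * detRows n (minorRows τ k)))
    ≈⟨ linear-in-minor (s k) (ρ 0 k) x (detRows n (minorRows σ k)) (detRows n (minorRows τ k)) ⟩
      s k * (ρ 0 k * detRows n (minorRows σ k)) + x * (s k * (ρ 0 k * detRows n (minorRows τ k)))
    ≈⟨ +-cong (*-congˡ (*-congʳ (ρ≋σ 0 (λ ()) k))) (*-congˡ (*-congˡ (*-congʳ (ρ≋τ 0 (λ ()) k)))) ⟩
      cofactor σ k + x * cofactor τ k
    ∎
    where
    s : Fin (suc n) → Carrier
    s = sign R ∘ toℕ
    linear-in-minor : ∀ s a x e f → s * (a * (e + x * f)) ≈ s * (a * e) + x * (s * (a * f))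
    linear-in-minor = solve 5 (λ s a x e f → s :* (a :* (e :+ x :* f)) := s :* (a :* e) :+ x :* (s :* (a :* f))) refl

  cofactor-zeroˡ : ∀ {n} (ρ : Rows (suc n)) k → ρ 0 k ≈ 0# → cofactor ρ k ≈ 0#
  cofactor-zeroˡ ρ k ρ₀ₖ≈0 = begin
    sign R (toℕ k) * (ρ 0 k * _) ≈⟨ *-congˡ (*-congʳ ρ₀ₖ≈0) ⟩
    sign R (toℕ k) * (0# * _)    ≈⟨ *-congˡ (zeroˡ _) ⟩
    sign R (toℕ k) * 0#          ≈⟨ zeroʳ _ ⟩
    0#                           ∎

  cofactor-zeroʳ : ∀ {n} (ρ : Rows (suc n)) k → detRows n (minorRows ρ k) ≈ 0# → cofactor ρ k ≈ 0#
  cofactor-zeroʳ ρ k minor≈0 = begin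
    sign R (toℕ k) * (ρ 0 k * _) ≈⟨ *-congˡ (*-congˡ minor≈0) ⟩
    sign R (toℕ k) * (ρ 0 k * 0#) ≈⟨ *-congˡ (zeroʳ _) ⟩
    sign R (toℕ k) * 0#          ≈⟨ zeroʳ _ ⟩
    0#                           ∎

  -- Expansion along the first two rows when both equal a; G c is the minor on the columns c.
  doubleCofactorSum : ∀ {m} → Row (suc (suc m)) → ((Fin m → Fin (suc (suc m))) → Carrier) → Carrier
  doubleCofactorSum {m} a G = sumFin R (suc (suc m)) λ k → sign R (toℕ k) * (a k *
    sumFin R (suc m) λ l → sign R (toℕ l) * (a (punchIn k l) * G (punchIn k ∘ punchIn l)))

  -- The terms in which neither of the two rows uses column 0: the others cancel in pairs,
  -- the term taking column 0 from the first row against the one taking it from the second.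
  doubleCofactorSumᶜ : ∀ {m} → Row (suc (suc m)) → ((Fin m → Fin (suc (suc m))) → Carrier) → Carrier
  doubleCofactorSumᶜ {m} a G = sumFin R (suc m) λ k → sign R (toℕ k) * (a (suc k) *
    sumFin R m λ l → sign R (toℕ l) * (a (suc (punchIn k l)) * G (punchIn (suc k) ∘ punchIn (suc l))))

  sign-shifted-term : ∀ {m} s b a₀ y (t : Fin m → Carrier) →
    - s * (b * (1# * (a₀ * y) + sumFin R m λ l → - sign R (toℕ l) * t l))
      ≈ - (a₀ * (s * (b * y))) + s * (b * sumFin R m λ l → sign R (toℕ l) * t l)
  sign-shifted-term {m} s b a₀ y t = begin
      - s * (b * (1# * (a₀ * y) + sumFin R m λ l → - sign R (toℕ l) * t l))
    ≈⟨ *-congˡ (*-congˡ (+-cong (*-identityˡ _)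
         (trans (sumFin-cong λ l → sym (-‿distribˡ-* _ (t l))) (sumFin-neg (λ l → sign R (toℕ l) * t l))))) ⟩
      - s * (b * (a₀ * y + - Z))
    ≈⟨ sym (-‿distribˡ-* _ _) ⟩
      - (s * (b * (a₀ * y + - Z)))
    ≈⟨ -‿cong (expand _ _ _ _ _) ⟩
      - (a₀ * (s * (b * y)) + s * (b * - Z))
    ≈⟨ sym (-‿+-comm _ _) ⟩
      - (a₀ * (s * (b * y))) + - (s * (b * - Z))
    ≈⟨ +-congˡ (-‿cong (trans (*-congˡ (sym (-‿distribʳ-* _ _))) (sym (-‿distribʳ-* _ _)))) ⟩
      - (a₀ * (s * (b * y))) + - - (s * (b * Z))
    ≈⟨ +-congˡ (-‿involutive _) ⟩
      - (a₀ * (s * (b * y))) + s * (b * Z)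
    ∎
    where
    Z : Carrier
    Z = sumFin R m λ l → sign R (toℕ l) * t l
    expand : ∀ s b a₀ y z → s * (b * (a₀ * y + z)) ≈ a₀ * (s * (b * y)) + s * (b * z)
    expand = solve 5 (λ s b a₀ y z → s :* (b :* (a₀ :* y :+ z)) := a₀ :* (s :* (b :* y)) :+ s :* (b :* z)) refl

  doubleCofactorSum≈ᶜ : ∀ {m} a G → doubleCofactorSum {m} a G ≈ doubleCofactorSumᶜ a G
  doubleCofactorSum≈ᶜ {m} a G = begin
      1# * (a zero * X) + sumFin R (suc m) (λ k → - s k * (a (suc k) *
        (1# * (a zero * Y k) + sumFin R m λ l → - s l * t k l)))
    ≈⟨ +-cong (*-identityˡ _) (sumFin-cong λ k → sign-shifted-term (s k) (a (suc k)) (a zero) (Y k) (t k)) ⟩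
      a zero * X + sumFin R (suc m) (λ k → - (a zero * x k) + q k)
    ≈⟨ +-congˡ (sumFin-+ (λ k → - (a zero * x k)) q) ⟩
      a zero * X + (sumFin R (suc m) (λ k → - (a zero * x k)) + doubleCofactorSumᶜ a G)
    ≈⟨ +-congˡ (+-congʳ (trans (sumFin-neg (λ k → a zero * x k)) (-‿cong (sumFin-*ˡ (a zero) x)))) ⟩
      a zero * X + (- (a zero * X) + doubleCofactorSumᶜ a G)
    ≈⟨ sym (+-assoc _ _ _) ⟩
      (a zero * X + - (a zero * X)) + doubleCofactorSumᶜ a G
    ≈⟨ +-congʳ (-‿inverseʳ _) ⟩
      0# + doubleCofactorSumᶜ a G
    ≈⟨ +-identityˡ _ ⟩
      doubleCofactorSumᶜ a G
    ∎
    where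
    s : ∀ {n} → Fin n → Carrier
    s = sign R ∘ toℕ
    Y : Fin (suc m) → Carrier
    Y k = G (suc ∘ punchIn k)
    x : Fin (suc m) → Carrier
    x k = s k * (a (suc k) * Y k)
    X : Carrier
    X = sumFin R (suc m) x
    t : Fin (suc m) → Fin m → Carrier
    t k l = a (suc (punchIn k l)) * G (punchIn (suc k) ∘ punchIn (suc l))
    Z : Fin (suc m) → Carrier
    Z k = sumFin R m λ l → s l * t k l
    q : Fin (suc m) → Carrier
    q k = s k * (a (suc k) * Z k)

  doubleCofactorSum≈0 : ∀ {m} a G → (∀ {c c′} → c ≗ c′ → G c ≈ G c′) → doubleCofactorSum {m} a G ≈ 0#
  doubleCofactorSum≈0 {zero} a G _ = trans (doubleCofactorSum≈ᶜ a G)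
    (sumFin-zero λ k → trans (*-congˡ (zeroʳ (a (suc k)))) (zeroʳ (sign R (toℕ k))))
  doubleCofactorSum≈0 {suc m} a G G-resp = begin
      doubleCofactorSum a G
    ≈⟨ doubleCofactorSum≈ᶜ a G ⟩
      doubleCofactorSumᶜ a G
    ≈⟨ sumFin-cong (λ k → *-congˡ {sign R (toℕ k)} (*-congˡ {a (suc k)} (sumFin-cong λ l →
         *-congˡ {sign R (toℕ l)} (*-congˡ {a (suc (punchIn k l))} (G-resp (punchIn-suc k l)))))) ⟩
      doubleCofactorSum (a ∘ suc) G₀
    ≈⟨ doubleCofactorSum≈0 (a ∘ suc) G₀ (G-resp ∘ cons-cong) ⟩
      0#
    ∎
    where
    G₀ : (Fin m → Fin (suc (suc m))) → Carrier
    G₀ c = G (zero ∷ suc ∘ c)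
    punchIn-suc : ∀ k l → punchIn (suc k) ∘ punchIn (suc l) ≗ zero ∷ suc ∘ punchIn k ∘ punchIn l
    punchIn-suc k l zero    = ≡.refl
    punchIn-suc k l (suc j) = ≡.refl
    cons-cong : ∀ {c c′ : Fin m → Fin (suc (suc m))} → c ≗ c′ → zero ∷ suc ∘ c ≗ zero ∷ suc ∘ c′
    cons-cong c≗c′ zero    = ≡.refl
    cons-cong c≗c′ (suc j) = ≡.cong suc (c≗c′ j)

  detRows-adjacent-equal : ∀ {n} (ρ : Rows n) j → suc j < n → ρ j ≋ ρ (suc j) → detRows n ρ ≈ 0#
  detRows-adjacent-equal {suc (suc m)} ρ zero _ ρ₀≋ρ₁ = begin
      detRows _ ρ
    ≈⟨ sumFin-cong (λ k → *-congˡ {sign R (toℕ k)} (*-congˡ {ρ 0 k} (sumFin-cong λ l →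
         *-congˡ {sign R (toℕ l)} (*-congʳ {G (punchIn k ∘ punchIn l)} (≋-sym ρ₀≋ρ₁ (punchIn k l)))))) ⟩
      doubleCofactorSum (ρ 0) G
    ≈⟨ doubleCofactorSum≈0 (ρ 0) G (λ c≗c′ → detRows-cong λ i _ j →
         reflexive (≡.cong (ρ (suc (suc i))) (c≗c′ j))) ⟩
      0#
    ∎
    where
    G : (Fin m → Fin (suc (suc m))) → Carrier
    G c = detRows m (λ i → ρ (suc (suc i)) ∘ c)
  detRows-adjacent-equal {suc n} ρ (suc j) (s≤s 1+j<n) ρⱼ≋ρ₁₊ⱼ = sumFin-zero λ k →
    cofactor-zeroʳ ρ k (detRows-adjacent-equal (minorRows ρ k) j 1+j<n (ρⱼ≋ρ₁₊ⱼ ∘ punchIn k))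

  infixl 6 _[_]≔_
  _[_]≔_ : ∀ {n} → Rows n → ℕ → Row n → Rows n
  (ρ [ j ]≔ r) l with l ≟ j
  ... | yes _ = r
  ... | no  _ = ρ l

  []≔-same : ∀ {n} (ρ : Rows n) j r → (ρ [ j ]≔ r) j ≡ r
  []≔-same ρ j r with j ≟ j
  ... | yes _   = ≡.refl
  ... | no  j≢j = contradiction ≡.refl j≢j

  []≔-other : ∀ {n} (ρ : Rows n) {j} r {l} → l ≢ j → (ρ [ j ]≔ r) l ≡ ρ l
  []≔-other ρ {j} r {l} l≢j with l ≟ j
  ... | yes l≡j = contradiction l≡j l≢j
  ... | no  _   = ≡.refl

  []≔-self : ∀ {n} (ρ : Rows n) j l → (ρ [ j ]≔ ρ j) l ≡ ρ l
  []≔-self ρ j l with l ≟ j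
  ... | yes ≡.refl = ≡.refl
  ... | no  _      = ≡.refl

  []≔-[]≔-self : ∀ {n} (ρ : Rows n) i j l → (ρ [ i ]≔ ρ i [ j ]≔ ρ j) l ≡ ρ l
  []≔-[]≔-self ρ i j l with l ≟ j
  ... | yes ≡.refl = ≡.refl
  ... | no  _      = []≔-self ρ i l

  []≔-comm : ∀ {n} (ρ : Rows n) {i j} → i ≢ j → ∀ a b → ρ [ i ]≔ a [ j ]≔ b ≗ ρ [ j ]≔ b [ i ]≔ a
  []≔-comm ρ {i} {j} i≢j a b l = by-cases (l ≟ i) (l ≟ j)
    where
    by-cases : Dec (l ≡ i) → Dec (l ≡ j) → (ρ [ i ]≔ a [ j ]≔ b) l ≡ (ρ [ j ]≔ b [ i ]≔ a) l
    by-cases (yes ≡.refl) _ =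
      ≡.trans ([]≔-other _ b i≢j) (≡.trans ([]≔-same ρ l a) (≡.sym ([]≔-same _ l a)))
    by-cases (no l≢i) (yes ≡.refl) =
      ≡.trans ([]≔-same _ l b) (≡.sym (≡.trans ([]≔-other _ a l≢i) ([]≔-same ρ l b)))
    by-cases (no l≢i) (no l≢j) =
      ≡.trans ([]≔-other _ b l≢j) (≡.trans ([]≔-other ρ a l≢i)
        (≡.sym (≡.trans ([]≔-other _ a l≢i) ([]≔-other ρ b l≢j))))

  detRows-[]≔-+ : ∀ {n} (ρ : Rows n) j → j < n → ∀ a b →
                  detRows n (ρ [ j ]≔ (λ k → a k + b k)) ≈ detRows n (ρ [ j ]≔ a) + detRows n (ρ [ j ]≔ b)
  detRows-[]≔-+ ρ j j<n a b = trans (detRows-linear j j<n 1# other other rowⱼ) (+-congˡ (*-identityˡ _))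
    where
    other : ∀ {r r′} l → l ≢ j → (ρ [ j ]≔ r) l ≋ (ρ [ j ]≔ r′) l
    other l l≢j = ≋-reflexive (≡.trans ([]≔-other ρ _ l≢j) (≡.sym ([]≔-other ρ _ l≢j)))
    rowⱼ : (ρ [ j ]≔ (λ k → a k + b k)) j ≋ (λ k → (ρ [ j ]≔ a) j k + 1# * (ρ [ j ]≔ b) j k)
    rowⱼ k rewrite []≔-same ρ j (λ k → a k + b k) | []≔-same ρ j a | []≔-same ρ j b =
      +-congˡ (sym (*-identityˡ (b k)))

  detRows-swap : ∀ {n} (ρ : Rows n) j → suc j < n →
                 detRows n (ρ [ suc j ]≔ ρ j [ j ]≔ ρ (suc j)) ≈ - detRows n ρ
  detRows-swap {n} ρ j 1+j<n = +-inverseʳ-unique _ _ (begin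
      D ρ + D (P v u)
    ≈⟨ +-cong (sym (+-identityˡ _)) (sym (+-identityʳ _)) ⟩
      (0# + D ρ) + (D (P v u) + 0#)
    ≈⟨ +-cong (+-cong (sym (P-equal u)) (sym P-self)) (+-congˡ (sym (P-equal v))) ⟩
      (D (P u u) + D (P u v)) + (D (P v u) + D (P v v))
    ≈⟨ +-cong (sym (P-+ʳ u u v)) (sym (P-+ʳ v u v)) ⟩
      D (P u u+v) + D (P v u+v)
    ≈⟨ sym (detRows-[]≔-+ _ j j<n u v) ⟩
      D (P u+v u+v)
    ≈⟨ P-equal u+v ⟩
      0#
    ∎)
    where
    D : Rows n → Carrier
    D = detRows n
    j<n : j < n
    j<n = ≤-trans (n≤1+n _) 1+j<n
    1+j≢j : suc j ≢ j
    1+j≢j = >⇒≢ (n<1+n j)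
    P : Row n → Row n → Rows n
    P a b = ρ [ suc j ]≔ b [ j ]≔ a
    u v u+v : Row n
    u = ρ j
    v = ρ (suc j)
    u+v k = u k + v k
    P-equal : ∀ a → D (P a a) ≈ 0#
    P-equal a = detRows-adjacent-equal (P a a) j 1+j<n (≋-reflexive (≡.trans ([]≔-same _ j a)
      (≡.sym (≡.trans ([]≔-other _ a 1+j≢j) ([]≔-same ρ (suc j) a)))))
    P-self : D (P u v) ≈ D ρ
    P-self = detRows-cong λ l _ → ≋-reflexive ([]≔-[]≔-self ρ (suc j) j l)
    P≗ : ∀ a b → P a b ≗ ρ [ j ]≔ a [ suc j ]≔ b
    P≗ a b = []≔-comm ρ 1+j≢j b a
    P-+ʳ : ∀ a b c → D (P a (λ k → b k + c k)) ≈ D (P a b) + D (P a c)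
    P-+ʳ a b c = begin
      D (P a (λ k → b k + c k))                     ≈⟨ detRows-cong (λ l _ → ≋-reflexive (P≗ a _ l)) ⟩
      D (ρ [ j ]≔ a [ suc j ]≔ (λ k → b k + c k))   ≈⟨ detRows-[]≔-+ _ (suc j) 1+j<n b c ⟩
      D (ρ [ j ]≔ a [ suc j ]≔ b) + D (ρ [ j ]≔ a [ suc j ]≔ c)
        ≈⟨ sym (+-cong (detRows-cong λ l _ → ≋-reflexive (P≗ a b l))
                       (detRows-cong λ l _ → ≋-reflexive (P≗ a c l))) ⟩
      D (P a b) + D (P a c)                         ∎

  detRows-equal-rows : ∀ {n} (ρ : Rows n) {i j} → i < j → j < n → ρ i ≋ ρ j → detRows n ρ ≈ 0#
  detRows-equal-rows {n} ρ {i} {suc j} (s≤s i≤j) 1+j<n ρᵢ≋ρ₁₊ⱼ with m≤n⇒m<n∨m≡n i≤j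
  ... | inj₂ ≡.refl = detRows-adjacent-equal ρ i 1+j<n ρᵢ≋ρ₁₊ⱼ
  ... | inj₁ i<j    = begin
    detRows n ρ       ≈⟨ sym (-‿involutive _) ⟩
    - - detRows n ρ   ≈⟨ -‿cong (sym (detRows-swap ρ j 1+j<n)) ⟩
    - detRows n σ     ≈⟨ -‿cong (detRows-equal-rows σ i<j (≤-trans (n≤1+n _) 1+j<n) σᵢ≋σⱼ) ⟩
    - 0#              ≈⟨ -0#≈0# ⟩
    0#                ∎
    where
    σ : Rows n
    σ = ρ [ suc j ]≔ ρ j [ j ]≔ ρ (suc j)
    σᵢ≋σⱼ : σ i ≋ σ j
    σᵢ≋σⱼ = ≋-trans (≋-reflexive (≡.trans ([]≔-other _ _ (<⇒≢ i<j))
                                          ([]≔-other ρ _ (<⇒≢ (m≤n⇒m≤1+n i<j)))))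
              (≋-trans ρᵢ≋ρ₁₊ⱼ (≋-reflexive (≡.sym ([]≔-same _ j _))))

  detRows-add-multiple : ∀ {n} {ρ σ : Rows n} {i j} x → i < j → j < n →
                         (∀ l → l ≢ j → σ l ≋ ρ l) → σ j ≋ (λ k → ρ j k + x * ρ i k) →
                         detRows n σ ≈ detRows n ρ
  detRows-add-multiple {n} {ρ} {σ} {i} {j} x i<j j<n σ≋ρ σⱼ = begin
    detRows n σ                ≈⟨ detRows-linear j j<n x σ≋ρ σ≋τ σⱼ′ ⟩
    detRows n ρ + x * detRows n τ ≈⟨ +-congˡ (*-congˡ (detRows-equal-rows τ i<j j<n τᵢ≋τⱼ)) ⟩
    detRows n ρ + x * 0#       ≈⟨ +-congˡ (zeroʳ x) ⟩
    detRows n ρ + 0#           ≈⟨ +-identityʳ _ ⟩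
    detRows n ρ                ∎
    where
    τ : Rows n
    τ = ρ [ j ]≔ ρ i
    σ≋τ : ∀ l → l ≢ j → σ l ≋ τ l
    σ≋τ l l≢j = ≋-trans (σ≋ρ l l≢j) (≋-reflexive (≡.sym ([]≔-other ρ _ l≢j)))
    σⱼ′ : σ j ≋ (λ k → ρ j k + x * τ j k)
    σⱼ′ k = trans (σⱼ k) (+-congˡ (*-congˡ (≋-reflexive (≡.sym ([]≔-same ρ j (ρ i))) k)))
    τᵢ≋τⱼ : τ i ≋ τ j
    τᵢ≋τⱼ = ≋-trans (≋-reflexive ([]≔-other ρ _ (<⇒≢ i<j))) (≋-reflexive (≡.sym ([]≔-same ρ j (ρ i))))

  recurrenceRow : ∀ {n} → Carrier → Carrier → Rows n → Rows n
  recurrenceRow x y ρ (suc (suc i)) k = (ρ (suc (suc i)) k + x * ρ (suc i) k) + y * ρ i k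
  recurrenceRow x y ρ j             k = ρ j k

  recurrenceFrom : ∀ {n} → Carrier → Carrier → ℕ → Rows n → Rows n
  recurrenceFrom x y t ρ j with j <? t
  ... | yes _ = ρ j
  ... | no  _ = recurrenceRow x y ρ j

  module _ {n} (x y : Carrier) (ρ : Rows n) where

    recurrenceFrom-< : ∀ {t j} → j < t → recurrenceFrom x y t ρ j ≡ ρ j
    recurrenceFrom-< {t} {j} j<t with j <? t
    ... | yes _   = ≡.refl
    ... | no  j≮t = contradiction j<t j≮t

    recurrenceFrom-≮ : ∀ {t j} → ¬ j < t → recurrenceFrom x y t ρ j ≡ recurrenceRow x y ρ j
    recurrenceFrom-≮ {t} {j} j≮t with j <? t
    ... | yes j<t = contradiction j<t j≮t
    ... | no  _   = ≡.refl

    recurrenceFrom-other : ∀ {t j} → j ≢ t → recurrenceFrom x y t ρ j ≡ recurrenceFrom x y (suc t) ρ j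
    recurrenceFrom-other {t} {j} j≢t with j <? t
    ... | yes j<t = ≡.sym (recurrenceFrom-< (m<n⇒m<1+n j<t))
    ... | no  j≮t = ≡.sym (recurrenceFrom-≮ λ j<1+t → j≮t (≤∧≢⇒< (≤-pred j<1+t) j≢t))

    detRows-recurrenceFrom-step : ∀ i → suc (suc i) < n →
      detRows n (recurrenceFrom x y (suc (suc i)) ρ) ≈ detRows n (recurrenceFrom x y (suc (suc (suc i))) ρ)
    detRows-recurrenceFrom-step i t<n =
      trans (detRows-add-multiple y i<t t<n ρₜ≋σ ρₜ≋σ+yσ)
            (detRows-add-multiple x (n<1+n (suc i)) t<n σ≋ρₜ₊₁ σ≋ρₜ₊₁+xρₜ₊₁)
      where
      t : ℕ
      t = suc (suc i)
      i<t : i < t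
      i<t = m<n⇒m<1+n (n<1+n i)
      ρₜ ρₜ₊₁ σ : Rows n
      ρₜ   = recurrenceFrom x y t ρ
      ρₜ₊₁ = recurrenceFrom x y (suc t) ρ
      σ    = ρₜ₊₁ [ t ]≔ (λ k → ρ t k + x * ρ (suc i) k)
      ρₜ≋σ : ∀ l → l ≢ t → ρₜ l ≋ σ l
      ρₜ≋σ l l≢t = ≋-reflexive (≡.trans (recurrenceFrom-other l≢t) (≡.sym ([]≔-other ρₜ₊₁ _ l≢t)))
      ρₜ≋σ+yσ : ρₜ t ≋ (λ k → σ t k + y * σ i k)
      ρₜ≋σ+yσ k = begin
        ρₜ t k                                  ≡⟨ ≡.cong-app (recurrenceFrom-≮ {t} (<-irrefl ≡.refl)) k ⟩
        (ρ t k + x * ρ (suc i) k) + y * ρ i k   ≡⟨ ≡.cong₂ (λ a b → a + y * b)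
                                                     (≡.cong-app (≡.sym ([]≔-same ρₜ₊₁ t _)) k)
                                                     (≡.cong-app (≡.sym σᵢ≡ρᵢ) k) ⟩
        σ t k + y * σ i k                       ∎
        where
        σᵢ≡ρᵢ : σ i ≡ ρ i
        σᵢ≡ρᵢ = ≡.trans ([]≔-other ρₜ₊₁ _ (<⇒≢ i<t)) (recurrenceFrom-< (m<n⇒m<1+n i<t))
      σ≋ρₜ₊₁ : ∀ l → l ≢ t → σ l ≋ ρₜ₊₁ l
      σ≋ρₜ₊₁ l l≢t = ≋-reflexive ([]≔-other ρₜ₊₁ _ l≢t)
      σ≋ρₜ₊₁+xρₜ₊₁ : σ t ≋ (λ k → ρₜ₊₁ t k + x * ρₜ₊₁ (suc i) k)
      σ≋ρₜ₊₁+xρₜ₊₁ k = begin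
        σ t k                             ≡⟨ ≡.cong-app ([]≔-same ρₜ₊₁ t _) k ⟩
        ρ t k + x * ρ (suc i) k           ≡⟨ ≡.cong₂ (λ a b → a + x * b)
                                               (≡.cong-app (≡.sym (recurrenceFrom-< (n<1+n t))) k)
                                               (≡.cong-app (≡.sym (recurrenceFrom-< (m<n⇒m<1+n (n<1+n (suc i))))) k) ⟩
        ρₜ₊₁ t k + x * ρₜ₊₁ (suc i) k     ∎

    detRows-recurrenceFrom : ∀ k t → k ℕ.+ t ≡ n → 2 ≤ t → detRows n (recurrenceFrom x y t ρ) ≈ detRows n ρ
    detRows-recurrenceFrom zero    t             ≡.refl _ = detRows-cong λ l l<t → ≋-reflexive (recurrenceFrom-< l<t)
    detRows-recurrenceFrom (suc k) (suc (suc i)) k+t≡n  (s≤s (s≤s z≤n)) =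
      trans (detRows-recurrenceFrom-step i (≡.subst (suc (suc i) <_) k+t≡n (s≤s (m≤n+m _ k))))
            (detRows-recurrenceFrom k (suc (suc (suc i))) (≡.trans (+-suc k _) k+t≡n) (s≤s (s≤s z≤n)))

  detRows-column0-zero : ∀ {n} (ρ : Rows (suc n)) → (∀ i → ρ i zero ≈ 0#) → detRows (suc n) ρ ≈ 0#
  detRows-column0-zero {zero}  ρ ρᵢ₀≈0 = sumFin-zero {f = cofactor ρ} λ
    { zero → cofactor-zeroˡ ρ zero (ρᵢ₀≈0 0) }
  detRows-column0-zero {suc n} ρ ρᵢ₀≈0 = sumFin-zero {f = cofactor ρ} λ
    { zero    → cofactor-zeroˡ ρ zero (ρᵢ₀≈0 0)
    ; (suc k) → cofactor-zeroʳ ρ (suc k) (detRows-column0-zero (minorRows ρ (suc k)) (ρᵢ₀≈0 ∘ suc))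
    }

  detRows-column0-below : ∀ {n} (ρ : Rows (suc n)) → (∀ i → ρ (suc i) zero ≈ 0#) →
                          detRows (suc n) ρ ≈ ρ 0 zero * detRows n (λ i → ρ (suc i) ∘ suc)
  detRows-column0-below {zero}  ρ _       = trans (+-identityʳ _) (*-identityˡ _)
  detRows-column0-below {suc n} ρ ρᵢ₀≈0 = begin
      1# * (ρ 0 zero * detRows (suc n) (minorRows ρ zero)) + sumFin R (suc n) (cofactor ρ ∘ suc)
    ≈⟨ +-cong (*-identityˡ _) (sumFin-zero {f = cofactor ρ ∘ suc} λ k →
         cofactor-zeroʳ ρ (suc k) (detRows-column0-zero (minorRows ρ (suc k)) ρᵢ₀≈0)) ⟩
      ρ 0 zero * detRows (suc n) (minorRows ρ zero) + 0#
    ≈⟨ +-identityʳ _ ⟩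
      ρ 0 zero * detRows (suc n) (λ i → ρ (suc i) ∘ suc)
    ∎

  detRows-upperTriangular : ∀ {n} (ρ : Rows n) x → (∀ i (j : Fin n) → toℕ j < i → ρ i j ≈ 0#) →
                            (∀ j → ρ (toℕ j) j ≈ x) → detRows n ρ ≈ pow R x n
  detRows-upperTriangular {zero}  ρ x _     _    = refl
  detRows-upperTriangular {suc n} ρ x below diag = trans (detRows-column0-below ρ λ i → below (suc i) zero (s≤s z≤n))
    (*-cong (diag zero) (detRows-upperTriangular (λ i → ρ (suc i) ∘ suc) x
      (λ i j j<i → below (suc i) (suc j) (s≤s j<i)) (diag ∘ suc)))

  detRows-block : ∀ {m} (ρ : Rows (suc (suc m))) →
                  (∀ i → ρ (suc (suc i)) zero ≈ 0#) → (∀ i → ρ (suc (suc i)) (suc zero) ≈ 0#) →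
                  detRows (suc (suc m)) ρ
                    ≈ (ρ 0 zero * ρ 1 (suc zero) - ρ 0 (suc zero) * ρ 1 zero)
                      * detRows m (λ i j → ρ (suc (suc i)) (suc (suc j)))
  detRows-block {m} ρ ρᵢ₀≈0 ρᵢ₁≈0 = begin
      1# * (a * detRows (suc m) (minorRows ρ zero))
        + (- 1# * (b * detRows (suc m) (minorRows ρ (suc zero))) + sumFin R m (λ k → cofactor ρ (suc (suc k))))
    ≈⟨ +-cong (trans (*-identityˡ _) (*-congˡ (detRows-column0-below (minorRows ρ zero) ρᵢ₁≈0)))
              (+-cong (trans (-1*x≈-x _) (-‿cong (*-congˡ (detRows-column0-below (minorRows ρ (suc zero)) ρᵢ₀≈0))))
                      (columns≥2 m ρ ρᵢ₀≈0 ρᵢ₁≈0)) ⟩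
      a * (d * U) + (- (b * (e * U)) + 0#)
    ≈⟨ +-cong (sym (*-assoc a d U)) (trans (+-identityʳ _) (trans (-‿cong (sym (*-assoc b e U))) (-‿distribˡ-* _ U))) ⟩
      (a * d) * U + (- (b * e)) * U
    ≈⟨ sym (distribʳ U _ _) ⟩
      (a * d - b * e) * U
    ∎
    where
    a b d e U : Carrier
    a = ρ 0 zero
    b = ρ 0 (suc zero)
    d = ρ 1 (suc zero)
    e = ρ 1 zero
    U = detRows m (λ i j → ρ (suc (suc i)) (suc (suc j)))
    columns≥2 : ∀ m (ρ : Rows (suc (suc m))) → (∀ i → ρ (suc (suc i)) zero ≈ 0#) →
                (∀ i → ρ (suc (suc i)) (suc zero) ≈ 0#) → sumFin R m (λ k → cofactor ρ (suc (suc k))) ≈ 0#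
    columns≥2 zero    ρ _     _     = refl
    columns≥2 (suc m) ρ ρᵢ₀≈0 ρᵢ₁≈0 = sumFin-zero {f = λ k → cofactor ρ (suc (suc k))} λ k →
      cofactor-zeroʳ ρ (suc (suc k)) (begin
          detRows (suc (suc m)) (minorRows ρ (suc (suc k)))
        ≈⟨ detRows-column0-below (minorRows ρ (suc (suc k))) ρᵢ₀≈0 ⟩
          ρ 1 zero * detRows (suc m) (ρ′ k)
        ≈⟨ *-congˡ (detRows-column0-zero (ρ′ k) ρᵢ₁≈0) ⟩
          ρ 1 zero * 0#
        ≈⟨ zeroʳ _ ⟩
          0#
        ∎)
      where
      ρ′ : Fin (suc m) → Rows (suc m)
      ρ′ k i j = ρ (suc (suc i)) (punchIn (suc (suc k)) (suc j))

module Toeplitz {c ℓ : Level} (R : CommutativeRing c ℓ) where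
  open CommutativeRing R hiding (zero)
  open import Algebra.Properties.Ring ring using (xyx⁻¹≈y; -‿distribˡ-*; -‿distribʳ-*; -‿+-comm; -‿involutive)
  open import Relation.Binary.Reasoning.Setoid setoid
  open Determinant R using (Rows; recurrenceFrom)

  module Recurrence (A B : Carrier) (w : ℕ → Carrier)
                    (w-rec : ∀ n → w (suc (suc n)) ≈ A * w (suc n) - B * w n) where

    toeplitz : ∀ {n} → Rows n
    toeplitz j k = w ∣ suc j - toℕ k ∣

    reduced : ∀ {n} → Rows n
    reduced = recurrenceFrom (- A) B 2 toeplitz

    diagonal : Carrier
    diagonal = (B + 1#) * w 1 - A * w 0

    ∣1+m-n∣≡1+∣m-n∣ : ∀ {m n} → n ≤ m → ∣ suc m - n ∣ ≡ suc ∣ m - n ∣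
    ∣1+m-n∣≡1+∣m-n∣ {m} n≤m = ≡.trans (m≤n⇒∣n-m∣≡n∸m (m≤n⇒m≤1+n n≤m))
      (≡.trans (+-∸-assoc 1 n≤m) (≡.cong suc (≡.sym (m≤n⇒∣n-m∣≡n∸m n≤m))))

    reduced-below : ∀ {n} i (k : Fin n) → toℕ k ≤ suc i → reduced (suc (suc i)) k ≈ 0#
    reduced-below i k k≤1+i = begin
        (w ∣ suc (suc (suc i)) - toℕ k ∣ + - A * w ∣ suc (suc i) - toℕ k ∣) + B * w e
      ≡⟨ ≡.cong₂ (λ p q → (w p + - A * w q) + B * w e) 3+i-k 2+i-k ⟩
        (w (suc (suc e)) + - A * w (suc e)) + B * w e
      ≈⟨ +-congʳ (+-cong (w-rec e) (sym (-‿distribˡ-* A (w (suc e))))) ⟩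
        ((A * w (suc e) - B * w e) - A * w (suc e)) + B * w e
      ≈⟨ +-congʳ (xyx⁻¹≈y _ _) ⟩
        - (B * w e) + B * w e
      ≈⟨ -‿inverseˡ _ ⟩
        0#
      ∎
      where
      e : ℕ
      e = ∣ suc i - toℕ k ∣
      2+i-k : ∣ suc (suc i) - toℕ k ∣ ≡ suc e
      2+i-k = ∣1+m-n∣≡1+∣m-n∣ k≤1+i
      3+i-k : ∣ suc (suc (suc i)) - toℕ k ∣ ≡ suc (suc e)
      3+i-k = ≡.trans (∣1+m-n∣≡1+∣m-n∣ (m≤n⇒m≤1+n k≤1+i)) (≡.cong suc 2+i-k)

    reduced-diagonal : ∀ {n} (j : Fin n) → reduced (suc (suc (toℕ j))) (suc (suc j)) ≈ diagonal
    reduced-diagonal j = begin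
        (w ∣ suc (toℕ j) - toℕ j ∣ + - A * w ∣ toℕ j - toℕ j ∣) + B * w ∣ toℕ j - suc (toℕ j) ∣
      ≡⟨ ≡.cong₂ _+_ (≡.cong₂ (λ p q → w p + - A * w q) 1+j-j (∣n-n∣≡0 (toℕ j)))
                     (≡.cong (λ p → B * w p) j-1+j) ⟩
        (w 1 + - A * w 0) + B * w 1
      ≈⟨ +-comm _ _ ⟩
        B * w 1 + (w 1 + - A * w 0)
      ≈⟨ sym (+-assoc _ _ _) ⟩
        (B * w 1 + w 1) + - A * w 0
      ≈⟨ +-cong (+-congˡ (sym (*-identityˡ (w 1)))) (sym (-‿distribˡ-* A (w 0))) ⟩
        (B * w 1 + 1# * w 1) - A * w 0
      ≈⟨ +-congʳ (sym (distribʳ (w 1) B 1#)) ⟩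
        diagonal
      ∎
      where
      1+j-j : ∣ suc (toℕ j) - toℕ j ∣ ≡ 1
      1+j-j = ≡.trans (m≤n⇒∣n-m∣≡n∸m (n≤1+n (toℕ j))) (m+n∸n≡m 1 (toℕ j))
      j-1+j : ∣ toℕ j - suc (toℕ j) ∣ ≡ 1
      j-1+j = ≡.trans (m≤n⇒∣m-n∣≡n∸m (n≤1+n (toℕ j))) (m+n∸n≡m 1 (toℕ j))

    leading-minor : w 1 * w 1 - w 0 * w 2 ≈ w 1 * w 1 - A * w 0 * w 1 + B * (w 0 * w 0)
    leading-minor = begin
        w 1 * w 1 - w 0 * w 2
      ≈⟨ +-congˡ (-‿cong (*-congˡ (w-rec 0))) ⟩
        w 1 * w 1 - w 0 * (A * w 1 - B * w 0)
      ≈⟨ +-congˡ (-‿cong (distribˡ (w 0) _ _)) ⟩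
        w 1 * w 1 - (w 0 * (A * w 1) + w 0 * - (B * w 0))
      ≈⟨ +-congˡ (-‿cong (+-cong
           (trans (sym (*-assoc _ _ _)) (*-congʳ (*-comm _ _)))
           (trans (sym (-‿distribʳ-* _ _))
                  (-‿cong (trans (sym (*-assoc _ _ _)) (trans (*-congʳ (*-comm _ _)) (*-assoc _ _ _))))))) ⟩
        w 1 * w 1 - (A * w 0 * w 1 + - (B * (w 0 * w 0)))
      ≈⟨ +-congˡ (sym (-‿+-comm _ _)) ⟩
        w 1 * w 1 + (- (A * w 0 * w 1) + - - (B * (w 0 * w 0)))
      ≈⟨ +-congˡ (+-congˡ (-‿involutive _)) ⟩
        w 1 * w 1 + (- (A * w 0 * w 1) + B * (w 0 * w 0))
      ≈⟨ sym (+-assoc _ _ _) ⟩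
        w 1 * w 1 - A * w 0 * w 1 + B * (w 0 * w 0)
      ∎

theorem1p2 : {c ℓ : Level} (R : CommutativeRing c ℓ) →
    let open CommutativeRing R in
    (A B : Carrier) (w : ℕ → Carrier) →
    (∀ n → w (suc (suc n)) ≈ A * w (suc n) - B * w n) →
    ∀ m →
      det R (suc (suc m)) (λ j k → w ∣ suc (toℕ j) - toℕ k ∣)
        ≈ (w 1 * w 1 - A * w 0 * w 1 + B * (w 0 * w 0))
          * pow R ((B + 1#) * w 1 - A * w 0) m
theorem1p2 R A B w w-rec m = begin
    detRows (suc (suc m)) toeplitz
  ≈⟨ sym (detRows-recurrenceFrom (- A) B toeplitz m 2 (ℕₚ.+-comm m 2) (s≤s (s≤s z≤n))) ⟩
    detRows (suc (suc m)) reduced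
  ≈⟨ detRows-block {m} reduced (λ i → reduced-below {suc (suc m)} i zero z≤n)
                               (λ i → reduced-below {suc (suc m)} i (suc zero) (s≤s z≤n)) ⟩
    (w 1 * w 1 - w 0 * w 2) * detRows m (λ i j → reduced (suc (suc i)) (suc (suc j)))
  ≈⟨ *-cong leading-minor (detRows-upperTriangular {m} _ diagonal
       (λ i j j<i → reduced-below i (suc (suc j)) (s≤s j<i)) reduced-diagonal) ⟩
    (w 1 * w 1 - A * w 0 * w 1 + B * (w 0 * w 0)) * pow R diagonal m
  ∎
  where
  open CommutativeRing R hiding (zero)
  open SetoidReasoning setoid
  open Determinant R using (detRows; detRows-recurrenceFrom; detRows-block; detRows-upperTriangular)
  open Toeplitz.Recurrence R A B w w-rec
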